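{- Let $G=(V,w)$ be a weighted graph and let $\mathcal{L}$ be a maximal cross-free family of cuts on $V$. Suppose that every $S\in\mathcal{L}$ has weight $w(S)=c$. Then the weight of a minimum cut of $G$ is $c$.
   Context: $G=(V,w)$ with nonnegative weights $w$ on unordered pairs of distinct vertices. A cut is determined by an unordered bipartition $\{X,V\setminus X\}$, $\emptyset\ne X\subsetneq V$, denoted $\Delta(X)$: the set of pairs with exactly one endpoint in $X$, of weight $w(\Delta(X))=\sum_{e\in\Delta(X)}w(e)$. Sets $X,Y$ cross if $X\cap Y$, $X\setminus Y$, $Y\setminus X$, $V\setminus(X\cup Y)$ are all nonempty; a family of distinct cuts is cross-free if no two have crossing shores, and maximal cross-free if no further cut can be added while keeping it cross-free.
   Formalization: The edge weights $w$ are nonnegative rationals instead of nonnegative reals, and the common cut weight $c$ is rational. -}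

module Defs where

open import Data.Nat as ℕ using (ℕ)
open import Data.Bool using (Bool; true; false; _xor_)
open import Data.Fin using (Fin; toℕ)
open import Data.Fin.Subset using (Subset; ∁; _∩_; _∪_; Nonempty)
open import Data.List using (List; map; foldr; allFin)
open import Data.List.Membership.Propositional using (_∈_)
open import Data.List.Relation.Unary.All using (All)
open import Data.List.Relation.Unary.AllPairs using (AllPairs)
open import Data.Product using (_×_; ∃)
open import Data.Sum using (_⊎_)
open import Data.Vec using (lookup)
open import Data.Rational using (ℚ; 0ℚ; _+_; _≤_)
open import Relation.Nullary using (¬_)
open import Relation.Binary.PropositionalEquality using (_≡_)

-- Weights on unordered pairs {i,j}, i ≠ j, of V = Fin n are read off
-- as w i j for toℕ i < toℕ j (other entries are ignored).
Weight : ℕ → Set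
Weight n = Fin n → Fin n → ℚ

NonnegWeight : ∀ {n} → Weight n → Set
NonnegWeight {n} w = ∀ (i j : Fin n) → toℕ i ℕ.< toℕ j → 0ℚ ≤ w i j

sumℚ : List ℚ → ℚ
sumℚ = foldr _+_ 0ℚ

pairTerm : ∀ {n} → Weight n → Subset n → Fin n → Fin n → ℚ
pairTerm w X i j with toℕ i ℕ.<ᵇ toℕ j | lookup X i xor lookup X j
... | true  | true  = w i j
... | _     | _     = 0ℚ

cutWeight : ∀ {n} → Weight n → Subset n → ℚ
cutWeight {n} w X = sumℚ (map (λ i → sumℚ (map (λ j → pairTerm w X i j) (allFin n))) (allFin n))

Shore : ∀ {n} → Subset n → Set
Shore X = Nonempty X × Nonempty (∁ X)

Cross : ∀ {n} → Subset n → Subset n → Set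
Cross X Y = Nonempty (X ∩ Y) × Nonempty (X ∩ ∁ Y) × Nonempty (∁ X ∩ Y) × Nonempty (∁ (X ∪ Y))

SameCut : ∀ {n} → Subset n → Subset n → Set
SameCut X Y = (X ≡ Y) ⊎ (X ≡ ∁ Y)

-- A family of cuts, given by a list of shores (one representative per cut),
-- is a maximal cross-free family of distinct cuts.
record MaximalCrossFree {n : ℕ} (L : List (Subset n)) : Set where
  field
    shores    : All Shore L
    distinct  : AllPairs (λ X Y → ¬ SameCut X Y) L
    crossFree : ∀ {X Y} → X ∈ L → Y ∈ L → ¬ Cross X Y
    maximal   : ∀ (X : Subset n) → Shore X → (∀ {Y} → Y ∈ L → ¬ Cross X Y) →
                ∃ λ Y → Y ∈ L × SameCut X Y

IsMinCutWeight : ∀ {n} → Weight n → ℚ → Set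
IsMinCutWeight {n} w c =
  (∃ λ (X : Subset n) → Shore X × cutWeight w X ≡ c) ×
  (∀ (X : Subset n) → Shore X → c ≤ cutWeight w X)

{-# OPTIONS --safe #-}
-- Represent every cut by its shore avoiding vertex 0, and show c ≤ w(X) for every nonempty such
-- shore X by induction on |X|. If X crosses no member of L, maximality makes Δ(X) a member, so
-- w(X) = c. Otherwise X crosses a member with 0-free shore Y. A member crossing Y ∖ X has a 0-free
-- shore strictly inside Y that still crosses X, so after finitely many such replacements Y ∖ X
-- crosses no member and w(Y ∖ X) = c = w(Y). Posimodularity w(X ∖ Y) + w(Y ∖ X) ≤ w(X) + w(Y)
-- then gives w(X) ≥ w(X ∖ Y) ≥ c by induction. The value c is attained since a maximal
-- cross-free family is nonempty.

module Submission where

open import Defs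
open import Data.Nat using (ℕ; _≤_)
open import Data.Fin.Subset using (Subset)
open import Data.List using (List)
open import Data.List.Membership.Propositional using (_∈_)
open import Data.Rational using (ℚ)
open import Relation.Binary.PropositionalEquality using (_≡_)

open import Algebra.Bundles using (CommutativeMonoid)
import Algebra.Lattice.Properties.BooleanAlgebra as BooleanAlgebraProperties
open import Data.Bool using (Bool; true; false; not; _∧_; _xor_; if_then_else_; f≤t; b≤b)
  renaming (_≤_ to _≤ᵇ_)
open import Data.Bool.Properties using (not-involutive; not-distribˡ-xor; not-distribʳ-xor)
open import Data.Empty using (⊥-elim)
open import Data.Fin using (Fin; zero; suc; toℕ)
open import Data.Fin.Subset using (∁; _∩_; _∪_; Nonempty; _⊆_; _⊂_; ∣_∣; ⁅_⁆; inside; outside)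
  renaming (_∈_ to _∈ₛ_; _∉_ to _∉ₛ_)
open import Data.Fin.Subset.Properties
  using (_∈?_; nonempty?; x∈p∩q⁺; x∈p∩q⁻; x∈p∪q⁻; p∩q⊆p; p∩q⊆q;
         x∈p⇒x∉∁p; x∈∁p⇒x∉p; x∉p⇒x∈∁p; x∉∁p⇒x∈p;
         p⊆q⇒∁p⊇∁q; p⊂q⇒∣p∣<∣q∣; ∩-comm; ∪-comm; ∪-∩-booleanAlgebra)
open import Data.List using ([]; _∷_; map; allFin)
open import Data.List.Properties using (map-cong)
open import Data.List.Membership.Propositional using (find; lose)
open import Data.List.Relation.Unary.Any using (any?; here)
open import Data.List.Relation.Unary.All as All using ()
open import Data.Nat using (suc; _<ᵇ_; _<_; s≤s)
open import Data.Nat.Induction using (<-wellFounded)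
open import Data.Nat.Properties using (<ᵇ⇒<)
open import Data.Product using (_×_; _,_; proj₁; proj₂; ∃)
open import Data.Rational using (0ℚ; _+_; -_)
import Data.Rational as ℚ
open import Data.Rational.Properties
  using (≤-refl; ≤-reflexive; ≤-trans; +-mono-≤; +-monoˡ-≤;
         +-comm; +-assoc; +-inverseʳ; +-identityʳ;
         +-0-commutativeMonoid)
open import Data.Sum using (_⊎_; inj₁; inj₂; [_,_])
open import Data.Unit using (tt)
open import Data.Vec using (lookup; _∷_; here; there)
open import Data.Vec.Properties using (lookup-map; lookup-zipWith)
open import Function using (_∘_)
open import Induction.WellFounded using (Acc; acc)
open import Relation.Binary.PropositionalEquality
  using (refl; sym; trans; cong; cong₂; subst; subst₂; module ≡-Reasoning)
open import Relation.Nullary using (¬_; Dec; yes; no)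
open import Relation.Nullary.Decidable using (_×-dec_)

open import Algebra.Properties.CommutativeSemigroup
  (CommutativeMonoid.commutativeSemigroup +-0-commutativeMonoid) using (interchange)

private
  variable
    n : ℕ

sumℚ-map-+-mono : ∀ {A : Set} (xs : List A) {f g h k : A → ℚ} →
  (∀ x → f x + g x ℚ.≤ h x + k x) →
  sumℚ (map f xs) + sumℚ (map g xs) ℚ.≤ sumℚ (map h xs) + sumℚ (map k xs)
sumℚ-map-+-mono []       _     = ≤-refl
sumℚ-map-+-mono (x ∷ xs) {f} {g} {h} {k} fg≤hk =
  subst₂ ℚ._≤_ (interchange (f x) (g x) _ _) (interchange (h x) (k x) _ _)
    (+-mono-≤ (fg≤hk x) (sumℚ-map-+-mono xs fg≤hk))

+-cancelʳ-≤ : ∀ p q r → p + r ℚ.≤ q + r → p ℚ.≤ q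
+-cancelʳ-≤ p q r p+r≤q+r = subst₂ ℚ._≤_ (+-r-r p) (+-r-r q) (+-monoˡ-≤ (- r) p+r≤q+r)
  where
  +-r-r : ∀ t → (t + r) + - r ≡ t
  +-r-r t = trans (+-assoc t r (- r)) (trans (cong (t +_) (+-inverseʳ r)) (+-identityʳ t))

separates : Subset n → Fin n → Fin n → Bool
separates X i j = lookup X i xor lookup X j

pairTerm≡if : ∀ (w : Weight n) X i j →
  pairTerm w X i j ≡ (if (toℕ i <ᵇ toℕ j) ∧ separates X i j then w i j else 0ℚ)
pairTerm≡if w X i j with toℕ i <ᵇ toℕ j | separates X i j
... | true  | true  = refl
... | true  | false = refl
... | false | _     = refl

pairTerm-cong : ∀ (w : Weight n) X Y i j → separates X i j ≡ separates Y i j →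
  pairTerm w X i j ≡ pairTerm w Y i j
pairTerm-cong w X Y i j sep≡ = begin
  pairTerm w X i j        ≡⟨ pairTerm≡if w X i j ⟩
  term (separates X i j)  ≡⟨ cong term sep≡ ⟩
  term (separates Y i j)  ≡⟨ pairTerm≡if w Y i j ⟨
  pairTerm w Y i j        ∎
  where
  open ≡-Reasoning
  term : Bool → ℚ
  term s = if (toℕ i <ᵇ toℕ j) ∧ s then w i j else 0ℚ

separates-∁ : ∀ (X : Subset n) i j → separates (∁ X) i j ≡ separates X i j
separates-∁ X i j = begin
  lookup (∁ X) i xor lookup (∁ X) j   ≡⟨ cong₂ _xor_ (lookup-map i not X) (lookup-map j not X) ⟩
  not a xor not b                     ≡⟨ sym (not-distribˡ-xor a (not b)) ⟩
  not (a xor not b)                   ≡⟨ cong not (sym (not-distribʳ-xor a b)) ⟩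
  not (not (a xor b))                 ≡⟨ not-involutive (a xor b) ⟩
  a xor b                             ∎
  where
  open ≡-Reasoning
  a = lookup X i
  b = lookup X j

cutWeight-∁ : ∀ (w : Weight n) X → cutWeight w (∁ X) ≡ cutWeight w X
cutWeight-∁ {n} w X = cong sumℚ (map-cong (λ i → cong sumℚ (map-cong (λ j →
  pairTerm-cong w (∁ X) X i j (separates-∁ X i j)) (allFin n))) (allFin n))

cutWeight-SameCut : ∀ (w : Weight n) {X Y} → SameCut X Y → cutWeight w X ≡ cutWeight w Y
cutWeight-SameCut w (inj₁ refl)         = refl
cutWeight-SameCut w {Y = Y} (inj₂ refl) = cutWeight-∁ w Y

Dominated : Bool → Bool → Bool → Bool → Set
Dominated s₁ s₂ t₁ t₂ = (s₁ ≤ᵇ t₁ × s₂ ≤ᵇ t₂) ⊎ (s₁ ≤ᵇ t₂ × s₂ ≤ᵇ t₁)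

if-mono : ∀ {s t q} → 0ℚ ℚ.≤ q → s ≤ᵇ t → (if s then q else 0ℚ) ℚ.≤ (if t then q else 0ℚ)
if-mono 0≤q f≤t = 0≤q
if-mono 0≤q b≤b = ≤-refl

if-+-mono : ∀ {s₁ s₂ t₁ t₂ q} → 0ℚ ℚ.≤ q → Dominated s₁ s₂ t₁ t₂ →
  (if s₁ then q else 0ℚ) + (if s₂ then q else 0ℚ) ℚ.≤
  (if t₁ then q else 0ℚ) + (if t₂ then q else 0ℚ)
if-+-mono 0≤q (inj₁ (s₁≤t₁ , s₂≤t₂)) = +-mono-≤ (if-mono 0≤q s₁≤t₁) (if-mono 0≤q s₂≤t₂)
if-+-mono {t₂ = t₂} {q = q} 0≤q (inj₂ (s₁≤t₂ , s₂≤t₁)) =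
  subst (_ ℚ.≤_) (+-comm (if t₂ then q else 0ℚ) _)
    (+-mono-≤ (if-mono 0≤q s₁≤t₂) (if-mono 0≤q s₂≤t₁))

-- aᵢ and bᵢ say whether i ∈ A and i ∈ B. The bound is strict exactly for the pairs joining
-- A ∩ B to the complement of A ∪ B.
posimodular-bits : ∀ aᵢ aⱼ bᵢ bⱼ →
  Dominated ((aᵢ ∧ not bᵢ) xor (aⱼ ∧ not bⱼ)) ((bᵢ ∧ not aᵢ) xor (bⱼ ∧ not aⱼ))
            (aᵢ xor aⱼ) (bᵢ xor bⱼ)
posimodular-bits true  true  true  true  = inj₁ (b≤b , b≤b)
posimodular-bits true  true  true  false = inj₂ (b≤b , b≤b)
posimodular-bits true  true  false true  = inj₂ (b≤b , b≤b)
posimodular-bits true  true  false false = inj₁ (b≤b , b≤b)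
posimodular-bits true  false true  true  = inj₂ (b≤b , b≤b)
posimodular-bits true  false true  false = inj₁ (f≤t , f≤t)
posimodular-bits true  false false true  = inj₁ (b≤b , b≤b)
posimodular-bits true  false false false = inj₁ (b≤b , b≤b)
posimodular-bits false true  true  true  = inj₂ (b≤b , b≤b)
posimodular-bits false true  true  false = inj₁ (b≤b , b≤b)
posimodular-bits false true  false true  = inj₁ (f≤t , f≤t)
posimodular-bits false true  false false = inj₁ (b≤b , b≤b)
posimodular-bits false false true  true  = inj₁ (b≤b , b≤b)
posimodular-bits false false true  false = inj₁ (b≤b , b≤b)
posimodular-bits false false false true  = inj₁ (b≤b , b≤b)
posimodular-bits false false false false = inj₁ (b≤b , b≤b)

lookup-∩∁ : ∀ (A B : Subset n) i → lookup (A ∩ ∁ B) i ≡ lookup A i ∧ not (lookup B i)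
lookup-∩∁ A B i = trans (lookup-zipWith _∧_ i A (∁ B)) (cong (lookup A i ∧_) (lookup-map i not B))

pairTerm-posimodular : ∀ {w : Weight n} → NonnegWeight w → ∀ A B i j →
  pairTerm w (A ∩ ∁ B) i j + pairTerm w (B ∩ ∁ A) i j ℚ.≤ pairTerm w A i j + pairTerm w B i j
pairTerm-posimodular {w = w} w≥0 A B i j
  rewrite pairTerm≡if w (A ∩ ∁ B) i j | pairTerm≡if w (B ∩ ∁ A) i j
        | pairTerm≡if w A i j | pairTerm≡if w B i j
        | lookup-∩∁ A B i | lookup-∩∁ A B j | lookup-∩∁ B A i | lookup-∩∁ B A j
  with toℕ i <ᵇ toℕ j | <ᵇ⇒< (toℕ i) (toℕ j)
... | false | _   = ≤-refl
... | true  | i<j = if-+-mono (w≥0 i j (i<j tt))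
                      (posimodular-bits (lookup A i) (lookup A j) (lookup B i) (lookup B j))

cutWeight-posimodular : ∀ {w : Weight n} → NonnegWeight w → ∀ A B →
  cutWeight w (A ∩ ∁ B) + cutWeight w (B ∩ ∁ A) ℚ.≤ cutWeight w A + cutWeight w B
cutWeight-posimodular {n} w≥0 A B =
  sumℚ-map-+-mono (allFin n) λ i → sumℚ-map-+-mono (allFin n) λ j → pairTerm-posimodular w≥0 A B i j

∁-involutive : ∀ (X : Subset n) → ∁ (∁ X) ≡ X
∁-involutive {n} = ¬-involutive
  where open BooleanAlgebraProperties (∪-∩-booleanAlgebra n) using (¬-involutive)

SameCut-sym : ∀ {X Y : Subset n} → SameCut X Y → SameCut Y X
SameCut-sym         (inj₁ refl) = inj₁ refl
SameCut-sym {Y = Y} (inj₂ refl) = inj₂ (sym (∁-involutive Y))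

Nonempty-mono : ∀ {p q : Subset n} → p ⊆ q → Nonempty p → Nonempty q
Nonempty-mono p⊆q (x , x∈p) = x , p⊆q x∈p

∩-monoˡ-⊆ : ∀ {p q : Subset n} r → p ⊆ q → p ∩ r ⊆ q ∩ r
∩-monoˡ-⊆ {p = p} r p⊆q x∈p∩r with x∈p∩q⁻ p r x∈p∩r
... | x∈p , x∈r = x∈p∩q⁺ (p⊆q x∈p , x∈r)

∩-monoʳ-⊆ : ∀ {q r : Subset n} p → q ⊆ r → p ∩ q ⊆ p ∩ r
∩-monoʳ-⊆ {q = q} p q⊆r x∈p∩q with x∈p∩q⁻ p q x∈p∩q
... | x∈p , x∈q = x∈p∩q⁺ (x∈p , q⊆r x∈q)

x∉p⇒x∉p∩q : ∀ {x : Fin n} {p} q → x ∉ₛ p → x ∉ₛ p ∩ q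
x∉p⇒x∉p∩q {p = p} q x∉p = x∉p ∘ proj₁ ∘ x∈p∩q⁻ p q

∣p∩∁q∣<∣p∣ : ∀ (p q : Subset n) → Nonempty (p ∩ q) → ∣ p ∩ ∁ q ∣ < ∣ p ∣
∣p∩∁q∣<∣p∣ p q (x , x∈p∩q) with x∈p∩q⁻ p q x∈p∩q
... | x∈p , x∈q = p⊂q⇒∣p∣<∣q∣ (p∩q⊆p p (∁ q) , x , x∈p , x∈p⇒x∉∁p x∈q ∘ proj₂ ∘ x∈p∩q⁻ p (∁ q))

cross? : ∀ (X Y : Subset n) → Dec (Cross X Y)
cross? X Y = nonempty? _ ×-dec nonempty? _ ×-dec nonempty? _ ×-dec nonempty? _

Cross-sym : ∀ {X Y : Subset n} → Cross X Y → Cross Y X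
Cross-sym {X = X} {Y} (X∩Y , X∖Y , Y∖X , neither) =
  subst Nonempty (∩-comm X Y) X∩Y ,
  subst Nonempty (∩-comm (∁ X) Y) Y∖X ,
  subst Nonempty (∩-comm X (∁ Y)) X∖Y ,
  subst Nonempty (cong ∁ (∪-comm X Y)) neither

Cross-∁ʳ : ∀ {X Y : Subset n} → Cross X Y → Cross X (∁ Y)
Cross-∁ʳ {n} {X} {Y} (X∩Y , X∖Y , Y∖X , neither) =
  X∖Y ,
  subst Nonempty (cong (X ∩_) (sym (∁-involutive Y))) X∩Y ,
  subst Nonempty (deMorgan₂ X Y) neither ,
  subst Nonempty (sym (trans (deMorgan₂ X (∁ Y)) (cong (∁ X ∩_) (∁-involutive Y)))) Y∖X
  where open BooleanAlgebraProperties (∪-∩-booleanAlgebra n) using (deMorgan₂)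

Cross-respʳ : ∀ {X Y Z : Subset n} → SameCut Y Z → Cross X Y → Cross X Z
Cross-respʳ                 (inj₁ refl) X⋈Y  = X⋈Y
Cross-respʳ {X = X} {Z = Z} (inj₂ refl) X⋈∁Z = subst (Cross X) (∁-involutive Z) (Cross-∁ʳ X⋈∁Z)

Cross-respˡ : ∀ {X Y Z : Subset n} → SameCut X Z → Cross X Y → Cross Z Y
Cross-respˡ X~Z = Cross-sym ∘ Cross-respʳ X~Z ∘ Cross-sym

zero-free-Shore : ∀ {X : Subset (suc n)} → zero ∉ₛ X → Nonempty X → Shore X
zero-free-Shore 0∉X X≠∅ = X≠∅ , zero , x∉p⇒x∈∁p 0∉X

zero-free-Cross : ∀ {X Y : Subset (suc n)} → zero ∉ₛ X → zero ∉ₛ Y →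
  Nonempty (X ∩ Y) → Nonempty (X ∩ ∁ Y) → Nonempty (∁ X ∩ Y) → Cross X Y
zero-free-Cross {X = X} {Y} 0∉X 0∉Y X∩Y X∖Y Y∖X =
  X∩Y , X∖Y , Y∖X , zero , x∉p⇒x∈∁p ([ 0∉X , 0∉Y ] ∘ x∈p∪q⁻ X Y)

zero-free-nested : ∀ {Y Z : Subset (suc n)} → zero ∉ₛ Y → zero ∉ₛ Z → ¬ Cross Y Z →
  Nonempty (Y ∩ Z) → Nonempty (Y ∩ ∁ Z) → Z ⊆ Y
zero-free-nested {Y = Y} 0∉Y 0∉Z ¬Y⋈Z Y∩Z Y∖Z {x} x∈Z with x ∈? Y
... | yes x∈Y = x∈Y
... | no  x∉Y = ⊥-elim (¬Y⋈Z (zero-free-Cross 0∉Y 0∉Z Y∩Z Y∖Z (x , x∈p∩q⁺ (x∉p⇒x∈∁p x∉Y , x∈Z))))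

zero-free-descent : ∀ {X Y Z : Subset (suc n)} → zero ∉ₛ X → zero ∉ₛ Y → zero ∉ₛ Z → ¬ Cross Y Z →
  Cross X Y → Cross (Y ∩ ∁ X) Z → Z ⊂ Y × Cross X Z
zero-free-descent {X = X} {Y} {Z} 0∉X 0∉Y 0∉Z ¬Y⋈Z (_ , X∖Y , _ , _) (D∩Z , D∖Z , Z∖D , _) =
  (Z⊆Y , Y∖Z) , zero-free-Cross 0∉X 0∉Z X∩Z (Nonempty-mono (∩-monoʳ-⊆ X (p⊆q⇒∁p⊇∁q Z⊆Y)) X∖Y) Z∖X
  where
  D⊆Y : Y ∩ ∁ X ⊆ Y
  D⊆Y = p∩q⊆p Y (∁ X)
  Z⊆Y : Z ⊆ Y
  Z⊆Y = zero-free-nested 0∉Y 0∉Z ¬Y⋈Z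
          (Nonempty-mono (∩-monoˡ-⊆ Z D⊆Y) D∩Z) (Nonempty-mono (∩-monoˡ-⊆ (∁ Z) D⊆Y) D∖Z)
  Y∖Z : ∃ λ x → x ∈ₛ Y × x ∉ₛ Z
  Y∖Z = let x , x∈D∖Z = D∖Z ; x∈D , x∈∁Z = x∈p∩q⁻ (Y ∩ ∁ X) (∁ Z) x∈D∖Z
        in x , D⊆Y x∈D , x∈∁p⇒x∉p x∈∁Z
  X∩Z : Nonempty (X ∩ Z)
  X∩Z = let x , x∈Z∖D = Z∖D ; x∈∁D , x∈Z = x∈p∩q⁻ (∁ (Y ∩ ∁ X)) Z x∈Z∖D
            x∉D = x∈∁p⇒x∉p x∈∁D
        in x , x∈p∩q⁺ (x∉∁p⇒x∈p (x∉D ∘ x∈p∩q⁺ ∘ (Z⊆Y x∈Z ,_)) , x∈Z)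
  Z∖X : Nonempty (∁ X ∩ Z)
  Z∖X = Nonempty-mono (∩-monoˡ-⊆ Z (p∩q⊆q Y (∁ X))) D∩Z

normalize : Subset (suc n) → Subset (suc n)
normalize (inside  ∷ X) = ∁ (inside ∷ X)
normalize (outside ∷ X) = outside ∷ X

zero∉normalize : ∀ (X : Subset (suc n)) → zero ∉ₛ normalize X
zero∉normalize (inside  ∷ X) ()
zero∉normalize (outside ∷ X) ()

normalize-SameCut : ∀ (X : Subset (suc n)) → SameCut (normalize X) X
normalize-SameCut (inside  ∷ X) = inj₂ refl
normalize-SameCut (outside ∷ X) = inj₁ refl

Cross-normalize : ∀ {X} (Y : Subset (suc n)) → Cross X Y → Cross X (normalize Y)
Cross-normalize Y = Cross-respʳ (SameCut-sym (normalize-SameCut Y))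

normalize-nonempty : ∀ {X : Subset (suc n)} → Shore X → Nonempty (normalize X)
normalize-nonempty {X = inside  ∷ X} (_ , ∁X≠∅) = ∁X≠∅
normalize-nonempty {X = outside ∷ X} (X≠∅ , _) = X≠∅

CrossesNone : List (Subset n) → Subset n → Set
CrossesNone L X = ∀ {W} → W ∈ L → ¬ Cross X W

crossesNone⊎crossesSome : ∀ (L : List (Subset n)) X → CrossesNone L X ⊎ ∃ λ W → W ∈ L × Cross X W
crossesNone⊎crossesSome L X with any? (cross? X) L
... | yes crossesSome = inj₂ (find crossesSome)
... | no  ¬crossesSome = inj₁ λ W∈L X⋈W → ¬crossesSome (lose W∈L X⋈W)

MaximalCrossFree-nonempty : ∀ {L : List (Subset n)} {X : Subset n} →
  MaximalCrossFree L → Shore X → ∃ λ S → S ∈ L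
MaximalCrossFree-nonempty {L = S ∷ _} _ _ = S , here refl
MaximalCrossFree-nonempty {L = []} {X} L-maximal X-shore
  with MaximalCrossFree.maximal L-maximal X X-shore (λ ())
... | _ , () , _

normalize-crossesNone : ∀ {L : List (Subset (suc n))} {S} → MaximalCrossFree L → S ∈ L →
  CrossesNone L (normalize S)
normalize-crossesNone {S = S} L-maximal S∈L W∈L nS⋈W =
  MaximalCrossFree.crossFree L-maximal S∈L W∈L (Cross-respˡ (normalize-SameCut S) nS⋈W)

module _ {L : List (Subset (suc n))} (L-maximal : MaximalCrossFree L) where

  crosser-with-uncrossed-difference : ∀ {X} → zero ∉ₛ X →
    ∀ Y → Acc _<_ ∣ Y ∣ → zero ∉ₛ Y → CrossesNone L Y → Cross X Y →
    ∃ λ Y′ → zero ∉ₛ Y′ × CrossesNone L Y′ × Cross X Y′ × CrossesNone L (Y′ ∩ ∁ X)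
  crosser-with-uncrossed-difference {X} 0∉X Y (acc smaller) 0∉Y Y-free X⋈Y
    with crossesNone⊎crossesSome L (Y ∩ ∁ X)
  ... | inj₁ D-free = Y , 0∉Y , Y-free , X⋈Y , D-free
  ... | inj₂ (Z , Z∈L , D⋈Z)
    with zero-free-descent 0∉X 0∉Y (zero∉normalize Z)
           (Y-free Z∈L ∘ Cross-respʳ (normalize-SameCut Z)) X⋈Y (Cross-normalize Z D⋈Z)
  ...   | Z′⊂Y , X⋈Z′ =
    crosser-with-uncrossed-difference 0∉X (normalize Z) (smaller (p⊂q⇒∣p∣<∣q∣ Z′⊂Y))
      (zero∉normalize Z) (normalize-crossesNone L-maximal Z∈L) X⋈Z′

  module _ {w : Weight (suc n)} (w≥0 : NonnegWeight w)
           {c : ℚ} (L-weight : ∀ {S} → S ∈ L → cutWeight w S ≡ c) where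

    uncrossed-weight : ∀ {X} → zero ∉ₛ X → Nonempty X → CrossesNone L X → cutWeight w X ≡ c
    uncrossed-weight {X} 0∉X X≠∅ X-free
      with MaximalCrossFree.maximal L-maximal X (zero-free-Shore 0∉X X≠∅) X-free
    ... | S , S∈L , X~S = trans (cutWeight-SameCut w X~S) (L-weight S∈L)

    zero-free-lower-bound : ∀ X → Acc _<_ ∣ X ∣ → zero ∉ₛ X → Nonempty X → c ℚ.≤ cutWeight w X
    zero-free-lower-bound X (acc smaller) 0∉X X≠∅ with crossesNone⊎crossesSome L X
    ... | inj₁ X-free = ≤-reflexive (sym (uncrossed-weight 0∉X X≠∅ X-free))
    ... | inj₂ (Y , Y∈L , X⋈Y)
      with crosser-with-uncrossed-difference 0∉X (normalize Y) (<-wellFounded _) (zero∉normalize Y)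
             (normalize-crossesNone L-maximal Y∈L) (Cross-normalize Y X⋈Y)
    ...   | Y′ , 0∉Y′ , Y′-free , (X∩Y′ , X∖Y′ , Y′∖X , _) , D-free =
      ≤-trans (zero-free-lower-bound (X ∩ ∁ Y′) (smaller (∣p∩∁q∣<∣p∣ X Y′ X∩Y′))
                                     (x∉p⇒x∉p∩q (∁ Y′) 0∉X) X∖Y′)
              (+-cancelʳ-≤ _ _ c posimodular)
      where
      D-weight : cutWeight w (Y′ ∩ ∁ X) ≡ c
      D-weight = uncrossed-weight (x∉p⇒x∉p∩q (∁ X) 0∉Y′)
                   (subst Nonempty (∩-comm (∁ X) Y′) Y′∖X) D-free
      Y′-weight : cutWeight w Y′ ≡ c
      Y′-weight = uncrossed-weight 0∉Y′ (Nonempty-mono (p∩q⊆q X Y′) X∩Y′) Y′-free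
      posimodular : cutWeight w (X ∩ ∁ Y′) + c ℚ.≤ cutWeight w X + c
      posimodular = subst₂ (λ d y → cutWeight w (X ∩ ∁ Y′) + d ℚ.≤ cutWeight w X + y)
                      D-weight Y′-weight (cutWeight-posimodular w≥0 X Y′)

    shore-lower-bound : ∀ {X} → Shore X → c ℚ.≤ cutWeight w X
    shore-lower-bound {X} X-shore =
      subst (c ℚ.≤_) (cutWeight-SameCut w (normalize-SameCut X))
        (zero-free-lower-bound (normalize X) (<-wellFounded _)
           (zero∉normalize X) (normalize-nonempty X-shore))

⁅zero⁆-Shore : Shore {suc (suc n)} ⁅ zero ⁆
⁅zero⁆-Shore = (zero , here) , (suc zero , there here)

lemma5p10 : (n : ℕ) → 2 ≤ n → (w : Weight n) → NonnegWeight w →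
            (L : List (Subset n)) → MaximalCrossFree L → (c : ℚ) →
            (∀ {S} → S ∈ L → cutWeight w S ≡ c) →
            IsMinCutWeight w c
lemma5p10 1 (s≤s ())
lemma5p10 (suc (suc m)) _ w w≥0 L L-maximal c L-weight
  with MaximalCrossFree-nonempty L-maximal ⁅zero⁆-Shore
... | S , S∈L = (S , All.lookup (MaximalCrossFree.shores L-maximal) S∈L , L-weight S∈L) ,
                λ _ → shore-lower-bound L-maximal w≥0 L-weight
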